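{- Let $n\ge 1$, let $\mathbf m=(m_1,\dots,m_n)$ be positive integers and $M=\sum_{i=1}^n m_i$. Then the combinatorial barcode lattice $\mathbf{BL}(\mathbf m)$ is isomorphic (as a poset) to a principal order ideal $[e,\beta]$ of the symmetric group $S_M$ under the weak Bruhat order, where $e$ is the identity. Explicitly, writing $M_i=\sum_{k=1}^i m_k$ ($M_0=0$) and $B_i=\{M_{i-1}+1,\dots,M_i\}$, $\beta$ is the permutation whose one-line notation lists first the smallest elements $M_0+1, M_1+1,\dots,M_{n-1}+1$ of the blocks $B_1,\dots,B_n$ in increasing order, then the remaining elements of $B_n$ in increasing order, then the remaining elements of $B_{n-1}$ in increasing order, and so on down to the remaining elements of $B_1$; and the isomorphism replaces the $j$-th occurrence of the label $i$ in a barcode by $M_{i-1}+j$.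
   Context: For positive integers $\mathbf m=(m_1,\dots,m_n)$, $\mathbf{BL}(\mathbf m)$ is the set of words (multiset permutations) of the multiset consisting of $m_i$ copies of $i$ for each $i\in[n]$, such that for each $i\in[n-1]$ the first occurrence of $i$ appears before the first occurrence of $i+1$. It is partially ordered by the reflexive-transitive closure of the covering relation: $s\lessdot t$ iff $t$ is obtained from $s$ by swapping two adjacent entries $a,b$ of $s$ with $a<b$ (so they appear as $ab$ in $s$ and $ba$ in $t$). The weak Bruhat order on $S_M$ (permutations in one-line notation) is the reflexive-transitive closure of: $\sigma\lessdot\tau$ iff $\tau$ is obtained from $\sigma$ by swapping two adjacent entries that are increasing in $\sigma$. -}

module Defs where

open import Data.Nat using (ℕ; zero; suc; _+_; _∸_; _≤_; _<_; _≡ᵇ_)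
open import Data.Nat.Properties using (_≟_)
open import Data.Bool using (if_then_else_)
open import Data.Nat.ListAction using (sum)
open import Data.List using (List; []; _∷_; _++_; length; filter; map; upTo; take; concat; reverse)
open import Data.List.Relation.Unary.All using (All)
open import Data.List.Relation.Binary.Permutation.Propositional using (_↭_)
open import Data.Product using (_×_)
open import Relation.Binary.Construct.Closure.ReflexiveTransitive using (Star)

-- Labels, barcode entries and permutation entries are natural numbers;
-- labels range over 1..n, permutation entries over 1..M (one-line notation).

count : ℕ → List ℕ → ℕ
count i w = length (filter (i ≟_) w)

-- 0-based position of the first occurrence of i in w (length w if absent)
firstOcc : ℕ → List ℕ → ℕ
firstOcc i [] = 0
firstOcc i (x ∷ w) = if i ≡ᵇ x then 0 else suc (firstOcc i w)

-- m_i for 1-based index i (m given as the list (m_1,...,m_n))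
mAt : List ℕ → ℕ → ℕ
mAt [] _ = 0
mAt (x ∷ xs) zero = 0
mAt (x ∷ xs) (suc zero) = x
mAt (x ∷ xs) (suc (suc k)) = mAt xs (suc k)

psum : List ℕ → ℕ → ℕ
psum m i = sum (take i m)

total : List ℕ → ℕ
total m = sum m

IsBL : List ℕ → List ℕ → Set
IsBL m w =
  All (λ x → 1 ≤ x × x ≤ length m) w
  × (∀ i → 1 ≤ i → i ≤ length m → count i w ≡ mAt m i)
  × (∀ i → 1 ≤ i → suc i ≤ length m → firstOcc i w < firstOcc (suc i) w)
  where open import Relation.Binary.PropositionalEquality using (_≡_)

data Cover : List ℕ → List ℕ → Set where
  swap : ∀ u a b v → a < b → Cover (u ++ a ∷ b ∷ v) (u ++ b ∷ a ∷ v)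

Leq : (List ℕ → Set) → List ℕ → List ℕ → Set
Leq P = Star (λ x y → P x × P y × Cover x y)

oneTo : ℕ → List ℕ
oneTo M = map suc (upTo M)

IsPerm : ℕ → List ℕ → Set
IsPerm M σ = σ ↭ oneTo M

idPerm : ℕ → List ℕ
idPerm M = oneTo M

-- remaining elements of block B_i (all but its smallest), increasing
restBlock : List ℕ → ℕ → List ℕ
restBlock m i = map (λ j → psum m (i ∸ 1) + suc (suc j)) (upTo (mAt m i ∸ 1))

beta : List ℕ → List ℕ
beta m = map (λ k → psum m k + 1) (upTo (length m))
         ++ concat (map (restBlock m) (reverse (oneTo (length m))))

InInterval : List ℕ → List ℕ → Set
InInterval m σ =
  IsPerm (total m) σ
  × Leq (IsPerm (total m)) (idPerm (total m)) σ
  × Leq (IsPerm (total m)) σ (beta m)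

-- relabelling: c i = number of occurrences of i already seen
relabel : List ℕ → (ℕ → ℕ) → List ℕ → List ℕ
relabel m c [] = []
relabel m c (i ∷ w) =
  (psum m (i ∸ 1) + suc (c i)) ∷ relabel m (λ k → if k ≡ᵇ i then suc (c k) else c k) w

phi : List ℕ → List ℕ → List ℕ
phi m w = relabel m (λ _ → 0) w

{-# OPTIONS --safe #-}

-- Let φ send the j-th occurrence of label i to M_{i-1} + j, and let blockOf send a value back to
-- its block, so that blockOf ∘ φ is the identity on words of content m and φ is injective.
-- Swapping an ascent ab of a barcode swaps the values of a and b in φ(w); these lie in the blocks
-- of a < b, so φ maps covers to covers. Conversely, two adjacent values of φ(w) from the same block
-- are consecutive and increasing, so swapping an ascent of φ(w) is the image of swapping an ascent
-- of w, and the result is again a barcode because barcodes are exactly the restricted growth words.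
-- Every barcode lies between 1^{m_1} 2^{m_2} … n^{m_n} and the word 1 2 … n followed by the
-- remaining labels in decreasing order, whose images are e and β; hence φ maps BL(m) onto [e, β].
module Submission where

open import Defs
open import Data.Nat using (ℕ; zero; suc; _+_; _∸_; _≤_; _<_; _≥_; _≡ᵇ_; _≤ᵇ_; z≤n; s≤s)
open import Data.Nat.Properties
open import Data.Bool using (true; false; if_then_else_)
open import Data.Product using (_×_; ∃; _,_; proj₁; proj₂)
open import Data.Sum using (inj₁; inj₂)
open import Data.List
  using (List; []; _∷_; _∷ʳ_; _++_; [_]; length; filter; map; replicate; applyUpTo; upTo; concat; reverse)
open import Data.List.Properties
  using (++-assoc; ++-identityʳ; ∷-injectiveˡ; ∷-injectiveʳ; length-++; length-map; length-replicate;
         filter-++; filter-accept; filter-reject; filter-none; filter-all; filter-some;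
         map-++; map-upTo; map-id; map-∘; map-cong; map-cong-local;
         concat-++; concat-map; unfold-reverse; reverse-map)
open import Data.List.Membership.Propositional using (_∈_)
open import Data.List.Relation.Unary.Any using (here; there)
open import Data.List.Relation.Unary.All using (All; []; _∷_)
import Data.List.Relation.Unary.All as All
import Data.List.Relation.Unary.All.Properties as AllP
open import Data.List.Relation.Unary.AllPairs using (AllPairs; []; _∷_)
import Data.List.Relation.Unary.AllPairs as AllPairs
import Data.List.Relation.Unary.AllPairs.Properties as AllPairsP
open import Data.List.Relation.Unary.Linked.Properties using (Linked⇒AllPairs)
open import Data.List.Relation.Binary.Permutation.Propositional
  using (_↭_; prep; ↭-refl; ↭-reflexive; ↭-sym; ↭-trans; ↭-swap)
open import Data.List.Relation.Binary.Permutation.Propositional.Properties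
  using (↭-length; filter-↭; ++⁺ˡ; ++-comm; ↭-reverse; All-resp-↭)
import Data.List.Sort.InsertionSort.Base as InsertionSort
import Data.List.Sort.InsertionSort.Properties as InsertionSortₚ
open import Relation.Binary.Construct.Closure.ReflexiveTransitive using (Star; ε; _◅_; _◅◅_)
import Relation.Binary.Construct.Flip.EqAndOrd as Flip
open import Relation.Nullary using (yes; no; contradiction)
open import Relation.Nullary.Decidable using (dec-true; dec-false)
open import Relation.Nullary.Reflects using (ofⁿ)
open import Relation.Binary.PropositionalEquality hiding ([_])
open import Function using (flip; _∘_)

open InsertionSort ≤-decTotalOrder using (insert; sort)
open InsertionSortₚ ≤-decTotalOrder using (sort-↗)
module Desc = InsertionSort (Flip.decTotalOrder ≤-decTotalOrder)
module Descₚ = InsertionSortₚ (Flip.decTotalOrder ≤-decTotalOrder)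

≡⇒≡ᵇ-true : ∀ {i x} → i ≡ x → (i ≡ᵇ x) ≡ true
≡⇒≡ᵇ-true {i} {x} = dec-true (i ≟ x)

≢⇒≡ᵇ-false : ∀ {i x} → i ≢ x → (i ≡ᵇ x) ≡ false
≢⇒≡ᵇ-false {i} {x} = dec-false (i ≟ x)

count-++ : ∀ i xs ys → count i (xs ++ ys) ≡ count i xs + count i ys
count-++ i xs ys = trans (cong length (filter-++ (i ≟_) xs ys)) (length-++ (filter (i ≟_) xs))

count-here : ∀ i w → count i (i ∷ w) ≡ suc (count i w)
count-here i w = cong length (filter-accept (i ≟_) refl)

count-there : ∀ {i x} w → i ≢ x → count i (x ∷ w) ≡ count i w
count-there {i} w i≢x = cong length (filter-reject (i ≟_) i≢x)

count-↭ : ∀ i {xs ys} → xs ↭ ys → count i xs ≡ count i ys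
count-↭ i xs↭ys = ↭-length (filter-↭ (i ≟_) xs↭ys)

count-none : ∀ {i} w → All (i ≢_) w → count i w ≡ 0
count-none {i} w i∉w = cong length (filter-none (i ≟_) i∉w)

count>0⇒∈ : ∀ i w → 0 < count i w → i ∈ w
count>0⇒∈ i (x ∷ w) count>0 with i ≟ x
... | yes refl = here refl
... | no i≢x = there (count>0⇒∈ i w (subst (0 <_) (count-there w i≢x) count>0))

∈⇒count>0 : ∀ {i w} → i ∈ w → 0 < count i w
∈⇒count>0 {i} = filter-some (i ≟_)

count-prefix< : ∀ i u v → 0 < count i v → count i u < count i (u ++ v)
count-prefix< i u v i∈v = subst (count i u <_) (sym (count-++ i u v))
  (subst (_≤ count i u + count i v) (+-comm (count i u) 1) (+-monoʳ-≤ (count i u) i∈v))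

count-map-suc : ∀ i w → count (suc i) (map suc w) ≡ count i w
count-map-suc i [] = refl
count-map-suc i (x ∷ w) with i ≟ x
... | yes refl = trans (count-here (suc i) (map suc w))
                       (trans (cong suc (count-map-suc i w)) (sym (count-here i w)))
... | no i≢x = trans (count-there (map suc w) (i≢x ∘ suc-injective))
                     (trans (count-map-suc i w) (sym (count-there w i≢x)))

∈-tail : ∀ {i x : ℕ} {w} → i ∈ x ∷ w → i ≢ x → i ∈ w
∈-tail (here i≡x) i≢x = contradiction i≡x i≢x
∈-tail (there i∈w) _ = i∈w

++-injective : ∀ (xs ys : List ℕ) {xs′ ys′} → length xs ≡ length ys →
  xs ++ xs′ ≡ ys ++ ys′ → xs ≡ ys × xs′ ≡ ys′
++-injective [] [] _ eq = refl , eq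
++-injective (x ∷ xs) (y ∷ ys) |xs|≡|ys| eq =
  let xs≡ys , xs′≡ys′ = ++-injective xs ys (suc-injective |xs|≡|ys|) (∷-injectiveʳ eq)
  in cong₂ _∷_ (∷-injectiveˡ eq) xs≡ys , xs′≡ys′

swap-heads : ∀ {x y x′ y′ : ℕ} {zs zs′} →
  _≡_ {A = List ℕ} (x ∷ y ∷ zs) (x′ ∷ y′ ∷ zs′) →
  _≡_ {A = List ℕ} (y ∷ x ∷ zs) (y′ ∷ x′ ∷ zs′)
swap-heads refl = refl

firstOcc-here : ∀ i w → firstOcc i (i ∷ w) ≡ 0
firstOcc-here i w rewrite ≡⇒≡ᵇ-true {i} refl = refl

firstOcc-there : ∀ {i x} w → i ≢ x → firstOcc i (x ∷ w) ≡ suc (firstOcc i w)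
firstOcc-there w i≢x rewrite ≢⇒≡ᵇ-false i≢x = refl

replicate-sorted : ∀ {R : ℕ → ℕ → Set} r {x} → R x x → AllPairs R (replicate r x)
replicate-sorted zero _ = []
replicate-sorted (suc r) Rxx = AllP.replicate⁺ r Rxx ∷ replicate-sorted r Rxx

AllPairs-count⇒≡ : ∀ {R : ℕ → ℕ → Set} → (∀ {x y} → R x y → R y x → x ≡ y) →
  ∀ {s t} → AllPairs R s → AllPairs R t → (∀ i → count i s ≡ count i t) → s ≡ t
AllPairs-count⇒≡ anti [] [] _ = refl
AllPairs-count⇒≡ anti [] (_∷_ {y} {t} _ _) same = contradiction (trans (same y) (count-here y t)) 0≢1+n
AllPairs-count⇒≡ anti (_∷_ {x} {s} _ _) [] same = contradiction (trans (sym (same x)) (count-here x s)) 0≢1+n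
AllPairs-count⇒≡ anti (_∷_ {x} {s} x≤s s↗) (_∷_ {y} {t} y≤t t↗) same with x ≟ y
... | yes refl = cong (x ∷_) (AllPairs-count⇒≡ anti s↗ t↗ same-tail)
  where
  same-tail : ∀ i → count i s ≡ count i t
  same-tail i = +-cancelˡ-≡ (count i [ x ]) _ _
    (trans (sym (count-++ i [ x ] s)) (trans (same i) (count-++ i [ x ] t)))
... | no x≢y = contradiction (anti (All.lookup x≤s y∈s) (All.lookup y≤t x∈t)) x≢y
  where
  y∈s : y ∈ s
  y∈s = count>0⇒∈ y s (subst (0 <_) (sym count-y) (s≤s z≤n))
    where count-y = trans (sym (count-there s (x≢y ∘ sym))) (trans (same y) (count-here y t))
  x∈t : x ∈ t
  x∈t = count>0⇒∈ x t (subst (0 <_) (sym count-x) (s≤s z≤n))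
    where count-x = trans (sym (count-there t x≢y)) (trans (sym (same x)) (count-here x s))

Chain : List ℕ → List ℕ → Set
Chain = Star Cover

cover-++⁺ˡ : ∀ p {x y} → Cover x y → Cover (p ++ x) (p ++ y)
cover-++⁺ˡ p (swap u a b v a<b) =
  subst₂ Cover (++-assoc p u (a ∷ b ∷ v)) (++-assoc p u (b ∷ a ∷ v)) (swap (p ++ u) a b v a<b)

chain-++⁺ˡ : ∀ p {x y} → Chain x y → Chain (p ++ x) (p ++ y)
chain-++⁺ˡ p ε = ε
chain-++⁺ˡ p (c ◅ cs) = cover-++⁺ˡ p c ◅ chain-++⁺ˡ p cs

swap-head : ∀ {a b} v → a < b → Chain (a ∷ b ∷ v) (b ∷ a ∷ v)
swap-head v a<b = swap [] _ _ v a<b ◅ ε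

cover⇒↭ : ∀ {x y} → Cover x y → x ↭ y
cover⇒↭ (swap u a b v _) = ++⁺ˡ u (↭-swap a b ↭-refl)

chain⇒↭ : ∀ {x y} → Chain x y → x ↭ y
chain⇒↭ ε = ↭-refl
chain⇒↭ (c ◅ cs) = ↭-trans (cover⇒↭ c) (chain⇒↭ cs)

chain⇒Leq : ∀ {M x y} → Chain x y → IsPerm M x → Leq (IsPerm M) x y
chain⇒Leq ε _ = ε
chain⇒Leq (c ◅ cs) x↭ = (x↭ , y↭ , c) ◅ chain⇒Leq cs y↭
  where y↭ = ↭-trans (↭-sym (cover⇒↭ c)) x↭

Leq⇒chain : ∀ {P : List ℕ → Set} {x y} → Leq P x y → Chain x y
Leq⇒chain ε = ε
Leq⇒chain ((_ , _ , c) ◅ cs) = c ◅ Leq⇒chain cs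

chain-bubble : ∀ x L R → All (x <_) L → Chain (x ∷ L ++ R) (L ++ x ∷ R)
chain-bubble x [] R [] = ε
chain-bubble x (y ∷ L) R (x<y ∷ x<L) = swap-head (L ++ R) x<y ◅◅ chain-++⁺ˡ [ y ] (chain-bubble x L R x<L)

-- insert branches on does (x ≤? y), which reduces to x ≤ᵇ y.
insert-chain : ∀ x xs → Chain (insert x xs) (x ∷ xs)
insert-chain x [] = ε
insert-chain x (y ∷ ys) with x ≤ᵇ y | ≤ᵇ-reflects-≤ x y
... | true | _ = ε
... | false | ofⁿ x≰y = chain-++⁺ˡ [ y ] (insert-chain x ys) ◅◅ swap-head ys (≰⇒> x≰y)

sort-chain : ∀ w → Chain (sort w) w
sort-chain [] = ε
sort-chain (x ∷ w) = insert-chain x (sort w) ◅◅ chain-++⁺ˡ [ x ] (sort-chain w)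

sort-sorted : ∀ w → AllPairs _≤_ (sort w)
sort-sorted w = Linked⇒AllPairs ≤-trans (sort-↗ w)

insertDesc-chain : ∀ x xs → Chain (x ∷ xs) (Desc.insert x xs)
insertDesc-chain x [] = ε
insertDesc-chain x (y ∷ ys) with y ≤ᵇ x | ≤ᵇ-reflects-≤ y x
... | true | _ = ε
... | false | ofⁿ y≰x = swap-head ys (≰⇒> y≰x) ◅◅ chain-++⁺ˡ [ y ] (insertDesc-chain x ys)

sortDesc-chain : ∀ w → Chain w (Desc.sort w)
sortDesc-chain [] = ε
sortDesc-chain (x ∷ w) = chain-++⁺ˡ [ x ] (sortDesc-chain w) ◅◅ insertDesc-chain x (Desc.sort w)

sortDesc-sorted : ∀ w → AllPairs _≥_ (Desc.sort w)
sortDesc-sorted w = Linked⇒AllPairs (flip ≤-trans) (Descₚ.sort-↗ w)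

-- The relabelling φ and the block map

tick : (ℕ → ℕ) → ℕ → ℕ → ℕ
tick c i k = if k ≡ᵇ i then suc (c k) else c k

counterAfter : (ℕ → ℕ) → List ℕ → ℕ → ℕ
counterAfter c [] = c
counterAfter c (i ∷ w) = counterAfter (tick c i) w

entry : List ℕ → (ℕ → ℕ) → ℕ → ℕ
entry m c i = psum m (i ∸ 1) + suc (c i)

tick-here : ∀ c i → tick c i i ≡ suc (c i)
tick-here c i rewrite ≡⇒≡ᵇ-true {i} refl = refl

tick-there : ∀ c {i k} → k ≢ i → tick c i k ≡ c k
tick-there c k≢i rewrite ≢⇒≡ᵇ-false k≢i = refl

tick-cong : ∀ {c c′} i {k} → c k ≡ c′ k → tick c i k ≡ tick c′ i k
tick-cong i {k} eq with k ≡ᵇ i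
... | true = cong suc eq
... | false = eq

tick-comm : ∀ c a b k → tick (tick c a) b k ≡ tick (tick c b) a k
tick-comm c a b k with k ≡ᵇ a | k ≡ᵇ b
... | true | true = refl
... | true | false = refl
... | false | true = refl
... | false | false = refl

counterAfter-count : ∀ c u k → counterAfter c u k ≡ c k + count k u
counterAfter-count c [] k = sym (+-identityʳ (c k))
counterAfter-count c (i ∷ u) k with k ≟ i
... | yes refl = begin
  counterAfter (tick c k) u k ≡⟨ counterAfter-count (tick c k) u k ⟩
  tick c k k + count k u      ≡⟨ cong (_+ count k u) (tick-here c k) ⟩
  suc (c k + count k u)       ≡⟨ sym (+-suc (c k) (count k u)) ⟩
  c k + suc (count k u)       ≡⟨ cong (c k +_) (sym (count-here k u)) ⟩
  c k + count k (k ∷ u)       ∎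
  where open ≡-Reasoning
... | no k≢i = trans (counterAfter-count (tick c i) u k)
  (cong₂ _+_ (tick-there c k≢i) (sym (count-there u k≢i)))

tick-count : ∀ c i k w → tick c i k + count k w ≡ c k + count k (i ∷ w)
tick-count c i k w = begin
  tick c i k + count k w            ≡⟨ cong (_+ count k w) (counterAfter-count c [ i ] k) ⟩
  c k + count k [ i ] + count k w   ≡⟨ +-assoc (c k) _ _ ⟩
  c k + (count k [ i ] + count k w) ≡⟨ cong (c k +_) (sym (count-++ k [ i ] w)) ⟩
  c k + count k (i ∷ w)             ∎
  where open ≡-Reasoning

relabel-++ : ∀ m c u v → relabel m c (u ++ v) ≡ relabel m c u ++ relabel m (counterAfter c u) v
relabel-++ m c [] v = refl
relabel-++ m c (i ∷ u) v = cong (_ ∷_) (relabel-++ m (tick c i) u v)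

length-relabel : ∀ m c w → length (relabel m c w) ≡ length w
length-relabel m c [] = refl
length-relabel m c (i ∷ w) = cong suc (length-relabel m (tick c i) w)

relabel-cong : ∀ m {c c′} w → All (λ k → c k ≡ c′ k) w → relabel m c w ≡ relabel m c′ w
relabel-cong m [] [] = refl
relabel-cong m {c} {c′} (i ∷ w) (eq ∷ eqs) =
  cong₂ _∷_ (cong (λ t → psum m (i ∸ 1) + suc t) eq) (relabel-cong m w (All.map (tick-cong {c} {c′} i) eqs))

relabel-adjacent : ∀ m c {a b} v → a ≢ b →
  relabel m c (a ∷ b ∷ v) ≡ entry m c a ∷ entry m c b ∷ relabel m (tick (tick c a) b) v
  × relabel m c (b ∷ a ∷ v) ≡ entry m c b ∷ entry m c a ∷ relabel m (tick (tick c a) b) v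
relabel-adjacent m c {a} {b} v a≢b =
  cong (λ t → entry m c a ∷ psum m (b ∸ 1) + suc t ∷ relabel m (tick (tick c a) b) v)
       (tick-there c (a≢b ∘ sym)) ,
  cong₂ (λ t rest → entry m c b ∷ psum m (a ∸ 1) + suc t ∷ rest) (tick-there c a≢b)
    (relabel-cong m v (All.universal (tick-comm c b a) v))

relabel-repeated : ∀ m c a v →
  relabel m c (a ∷ a ∷ v) ≡ entry m c a ∷ suc (entry m c a) ∷ relabel m (tick (tick c a) a) v
relabel-repeated m c a v =
  cong (λ t → entry m c a ∷ t ∷ relabel m (tick (tick c a) a) v)
       (trans (cong (λ t → psum m (a ∸ 1) + suc t) (tick-here c a)) (+-suc _ _))

blockOf : List ℕ → ℕ → ℕ
blockOf [] x = 0
blockOf (k ∷ ks) x with x ≤? k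
... | yes _ = 1
... | no _ = suc (blockOf ks (x ∸ k))

blockOf-entry : ∀ m i c → c < mAt m i → blockOf m (psum m (i ∸ 1) + suc c) ≡ i
blockOf-entry (k ∷ ks) (suc zero) c c<k with suc c ≤? k
... | yes _ = refl
... | no c≮k = contradiction c<k c≮k
blockOf-entry (k ∷ ks) (suc (suc j)) c c<m with k + psum ks j + suc c ≤? k
... | yes x≤k = contradiction x≤k (<⇒≱ (≤-<-trans (m≤m+n k _) (m<m+n _ (s≤s z≤n))))
... | no _ = cong suc (trans (cong (blockOf ks) (trans (cong (_∸ k) (+-assoc k _ _)) (m+n∸m≡n k _)))
                              (blockOf-entry ks (suc j) c c<m))

blockOf-mono : ∀ m {x y} → x ≤ y → blockOf m x ≤ blockOf m y
blockOf-mono [] _ = z≤n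
blockOf-mono (k ∷ ks) {x} {y} x≤y with x ≤? k | y ≤? k
... | yes _ | yes _ = ≤-refl
... | yes _ | no _ = s≤s z≤n
... | no x≰k | yes y≤k = contradiction (≤-trans x≤y y≤k) x≰k
... | no _ | no _ = s≤s (blockOf-mono ks (∸-monoˡ-≤ k x≤y))

blockOf-relabel : ∀ m c w → (∀ i → c i + count i w ≤ mAt m i) → map (blockOf m) (relabel m c w) ≡ w
blockOf-relabel m c [] _ = refl
blockOf-relabel m c (i ∷ w) bound =
  cong₂ _∷_ (blockOf-entry m i (c i) c<m) (blockOf-relabel m (tick c i) w bound′)
  where
  c<m : c i < mAt m i
  c<m = <-≤-trans (subst (c i <_) (cong (c i +_) (sym (count-here i w))) (m<m+n (c i) (s≤s z≤n))) (bound i)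
  bound′ : ∀ k → tick c i k + count k w ≤ mAt m k
  bound′ k = subst (_≤ mAt m k) (sym (tick-count c i k w)) (bound k)

mAt-zero : ∀ m → mAt m 0 ≡ 0
mAt-zero [] = refl
mAt-zero (_ ∷ _) = refl

mAt-beyond : ∀ m {i} → length m < i → mAt m i ≡ 0
mAt-beyond [] _ = refl
mAt-beyond (_ ∷ ks) {suc (suc i)} (s≤s n<i) = mAt-beyond ks n<i

mAt-positive : ∀ {m} → All (1 ≤_) m → ∀ {i} → 1 ≤ i → i ≤ length m → 0 < mAt m i
mAt-positive (k≥1 ∷ _) {suc zero} _ _ = k≥1
mAt-positive (_ ∷ ks≥1) {suc (suc i)} _ (s≤s i<n) = mAt-positive ks≥1 (s≤s z≤n) i<n

mAt>0⇒label : ∀ m {i} → 0 < mAt m i → 1 ≤ i × i ≤ length m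
mAt>0⇒label (_ ∷ _) {suc zero} _ = s≤s z≤n , s≤s z≤n
mAt>0⇒label (_ ∷ ks) {suc (suc i)} m>0 = s≤s z≤n , s≤s (proj₂ (mAt>0⇒label ks m>0))

HasContent : List ℕ → List ℕ → Set
HasContent m w = ∀ i → count i w ≡ mAt m i

HasContent-↭ : ∀ m {w w′} → w ↭ w′ → HasContent m w → HasContent m w′
HasContent-↭ m w↭w′ content i = trans (sym (count-↭ i w↭w′)) (content i)

HasContent⇒labels : ∀ {m w} → HasContent m w → All (λ x → 1 ≤ x × x ≤ length m) w
HasContent⇒labels {m} content =
  All.tabulate λ {x} x∈w → mAt>0⇒label m (subst (0 <_) (content x) (∈⇒count>0 x∈w))

IsBL⇒HasContent : ∀ m {w} → IsBL m w → HasContent m w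
IsBL⇒HasContent m {w} (labels , _ , _) zero =
  trans (count-none w (All.map (λ (0<x , _) → <⇒≢ 0<x) labels)) (sym (mAt-zero m))
IsBL⇒HasContent m {w} (labels , counts , _) (suc i) with suc i ≤? length m
... | yes i≤n = counts (suc i) (s≤s z≤n) i≤n
... | no i≰n = trans (count-none w (All.map (λ (_ , x≤n) → >⇒≢ (≤-<-trans x≤n (≰⇒> i≰n))) labels))
                     (sym (mAt-beyond m (≰⇒> i≰n)))

blockOf-phi : ∀ {m w} → HasContent m w → map (blockOf m) (phi m w) ≡ w
blockOf-phi {m} {w} content = blockOf-relabel m (λ _ → 0) w (λ i → ≤-reflexive (content i))

blockOf-entryAfter : ∀ m u v i → HasContent m (u ++ v) → 0 < count i v →
  blockOf m (entry m (counterAfter (λ _ → 0) u) i) ≡ i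
blockOf-entryAfter m u v i content i∈v = blockOf-entry m i _
  (subst₂ _<_ (sym (counterAfter-count (λ _ → 0) u i)) (content i) (count-prefix< i u v i∈v))

phi-++ : ∀ m u {x y} → relabel m (counterAfter (λ _ → 0) u) x ≡ y → phi m (u ++ x) ≡ phi m u ++ y
phi-++ m u eq = trans (relabel-++ m (λ _ → 0) u _) (cong (phi m u ++_) eq)

phi-split : ∀ m u {x y} → phi m (map (blockOf m) u ++ x) ≡ u ++ y →
  phi m (map (blockOf m) u) ≡ u × relabel m (counterAfter (λ _ → 0) (map (blockOf m) u)) x ≡ y
phi-split m u eq =
  ++-injective _ u (trans (length-relabel m (λ _ → 0) (map (blockOf m) u)) (length-map (blockOf m) u))
  (trans (sym (relabel-++ m (λ _ → 0) (map (blockOf m) u) _)) eq)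

phi-repeated-label : ∀ m u x v {a b} →
  phi m (map (blockOf m) u ++ x ∷ x ∷ map (blockOf m) v) ≡ u ++ b ∷ a ∷ v → a ≡ suc b
phi-repeated-label m u x v eq = trans (sym (∷-injectiveˡ (∷-injectiveʳ heads))) (cong suc (∷-injectiveˡ heads))
  where heads = trans (sym (relabel-repeated m _ x (map (blockOf m) v))) (proj₂ (phi-split m u eq))

phi-cover : ∀ m {w w′} → HasContent m w → Cover w w′ → Cover (phi m w) (phi m w′)
phi-cover m content (swap u a b v a<b) =
  subst₂ Cover (sym (phi-++ m u (proj₁ adjacent))) (sym (phi-++ m u (proj₂ adjacent)))
    (swap (phi m u) (entry m c a) (entry m c b) _ entryA<entryB)
  where
  c = counterAfter (λ _ → 0) u
  a≢b : a ≢ b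
  a≢b = <⇒≢ a<b
  adjacent = relabel-adjacent m c v a≢b
  blockA : blockOf m (entry m c a) ≡ a
  blockA = blockOf-entryAfter m u (a ∷ b ∷ v) a content
    (subst (0 <_) (sym (count-here a (b ∷ v))) (s≤s z≤n))
  blockB : blockOf m (entry m c b) ≡ b
  blockB = blockOf-entryAfter m u (a ∷ b ∷ v) b content
    (subst (0 <_) (sym (trans (count-there (b ∷ v) (a≢b ∘ sym)) (count-here b v))) (s≤s z≤n))
  entryA<entryB : entry m c a < entry m c b
  entryA<entryB = ≰⇒> λ b≤a → <⇒≱ a<b (subst₂ _≤_ blockB blockA (blockOf-mono m b≤a))

phi-chain : ∀ m {w w′} → HasContent m w → Chain w w′ → Chain (phi m w) (phi m w′)
phi-chain m content ε = ε
phi-chain m content (c ◅ cs) = phi-cover m content c ◅ phi-chain m (HasContent-↭ m (cover⇒↭ c) content) cs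

-- Barcodes as restricted growth words

FirstOccsOrdered : ℕ → ℕ → List ℕ → Set
FirstOccsOrdered k d w = ∀ i → k < i → suc i ≤ k + d → firstOcc i w < firstOcc (suc i) w

-- Growth k d w: the labels 1 … k have already been used before w, and w introduces
-- the new labels k+1, …, k+d in increasing order, every other entry being a repetition.
data Growth : ℕ → ℕ → List ℕ → Set where
  done : ∀ {k} → Growth k 0 []
  repeat : ∀ {k d x w} → x ≤ k → Growth k d w → Growth k d (x ∷ w)
  fresh : ∀ {k d w} → Growth (suc k) d w → Growth k (suc d) (suc k ∷ w)

firstOccsOrdered-∷ : ∀ {k d x} w → x ≤ k → FirstOccsOrdered k d w → FirstOccsOrdered k d (x ∷ w)
firstOccsOrdered-∷ {x = x} w x≤k ordered i k<i i<k+d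
  rewrite firstOcc-there w (>⇒≢ (≤-<-trans x≤k k<i))
        | firstOcc-there {suc i} w (>⇒≢ (≤-<-trans x≤k (m<n⇒m<1+n k<i)))
  = s≤s (ordered i k<i i<k+d)

firstOccsOrdered-⁻∷ : ∀ {k d x} w → x ≤ k → FirstOccsOrdered k d (x ∷ w) → FirstOccsOrdered k d w
firstOccsOrdered-⁻∷ {x = x} w x≤k ordered i k<i i<k+d
  with ordered i k<i i<k+d
... | lt rewrite firstOcc-there w (>⇒≢ (≤-<-trans x≤k k<i))
               | firstOcc-there {suc i} w (>⇒≢ (≤-<-trans x≤k (m<n⇒m<1+n k<i)))
  = ≤-pred lt

firstOccsOrdered-shift : ∀ {k d} w → FirstOccsOrdered k (suc d) w → FirstOccsOrdered (suc k) d w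
firstOccsOrdered-shift {k} {d} w ordered i k+1<i i<k+1+d =
  ordered i (<-trans (n<1+n k) k+1<i) (subst (suc i ≤_) (sym (+-suc k d)) i<k+1+d)

Growth⇒firstOccsOrdered : ∀ {k d w} → Growth k d w → FirstOccsOrdered k d w
Growth⇒firstOccsOrdered {k} done i k<i i<k+0 =
  contradiction (subst (suc i ≤_) (+-identityʳ k) i<k+0) (<⇒≱ (m<n⇒m<1+n k<i))
Growth⇒firstOccsOrdered (repeat {w = w} x≤k growth) =
  firstOccsOrdered-∷ w x≤k (Growth⇒firstOccsOrdered growth)
Growth⇒firstOccsOrdered {k} {suc d} (fresh {w = w} growth) i k<i i<k+d with i ≟ suc k
... | yes refl rewrite firstOcc-here (suc k) w | firstOcc-there {suc (suc k)} w (1+n≢n ∘ suc-injective)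
  = s≤s z≤n
... | no i≢k+1 = firstOccsOrdered-∷ w ≤-refl (Growth⇒firstOccsOrdered growth) i
  (≤∧≢⇒< k<i (i≢k+1 ∘ sym)) (subst (suc i ≤_) (+-suc k d) i<k+d)

firstNewLabel : ∀ {k d x} w → k < x → x ≤ k + d → FirstOccsOrdered k d (x ∷ w) → x ≡ suc k
firstNewLabel {k} {x = suc j} w k<x x≤k+d ordered with k ≟ j
... | yes refl = refl
... | no k≢j with ordered j (≤∧≢⇒< (≤-pred k<x) k≢j) x≤k+d
... | lt rewrite firstOcc-here (suc j) w = contradiction lt n≮0

firstOccsOrdered⇒Growth : ∀ k d w → All (_≤ k + d) w → (∀ i → k < i → i ≤ k + d → i ∈ w) →
  FirstOccsOrdered k d w → Growth k d w
firstOccsOrdered⇒Growth k zero [] _ _ _ = done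
firstOccsOrdered⇒Growth k (suc d) [] _ present _
  with present (suc k) ≤-refl (subst (suc k ≤_) (sym (+-suc k d)) (s≤s (m≤m+n k d)))
... | ()
firstOccsOrdered⇒Growth k d (x ∷ w) (x≤k+d ∷ w≤k+d) present ordered with x ≤? k
... | yes x≤k =
  repeat x≤k (firstOccsOrdered⇒Growth k d w w≤k+d present′ (firstOccsOrdered-⁻∷ w x≤k ordered))
  where
  present′ : ∀ i → k < i → i ≤ k + d → i ∈ w
  present′ i k<i i≤k+d = ∈-tail (present i k<i i≤k+d) (>⇒≢ (≤-<-trans x≤k k<i))
... | no x≰k with firstNewLabel w (≰⇒> x≰k) x≤k+d ordered
... | refl with d
...   | zero = contradiction (subst (suc k ≤_) (+-identityʳ k) x≤k+d) (n≮n k)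
...   | suc d′ = fresh (firstOccsOrdered⇒Growth (suc k) d′ w
                   (All.map (λ {y} → subst (y ≤_) (+-suc k d′)) w≤k+d)
                   present′ (firstOccsOrdered-⁻∷ w ≤-refl (firstOccsOrdered-shift (suc k ∷ w) ordered)))
  where
  present′ : ∀ i → suc k < i → i ≤ suc k + d′ → i ∈ w
  present′ i k+1<i i≤k+1+d′ =
    ∈-tail (present i (<-trans (n<1+n k) k+1<i) (subst (i ≤_) (sym (+-suc k d′)) i≤k+1+d′)) (>⇒≢ k+1<i)

IsBL⇒Growth : ∀ {m w} → All (1 ≤_) m → IsBL m w → Growth 0 (length m) w
IsBL⇒Growth {m} {w} m≥1 (labels , counts , ordered) =
  firstOccsOrdered⇒Growth 0 (length m) w (All.map proj₂ labels) present ordered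
  where
  present : ∀ i → 0 < i → i ≤ length m → i ∈ w
  present i 0<i i≤n = count>0⇒∈ i w (subst (0 <_) (sym (counts i 0<i i≤n)) (mAt-positive m≥1 0<i i≤n))

Growth-swap : ∀ {k d} u {a b} v → a < b → Growth k d (u ++ b ∷ a ∷ v) → Growth k d (u ++ a ∷ b ∷ v)
Growth-swap [] v a<b (repeat b≤k (repeat a≤k growth)) = repeat a≤k (repeat b≤k growth)
Growth-swap [] v a<b (repeat b≤k (fresh growth)) = contradiction (≤-trans b≤k (n≤1+n _)) (<⇒≱ a<b)
Growth-swap [] v a<b (fresh (repeat a≤k+1 growth)) = repeat (≤-pred a<b) (fresh growth)
Growth-swap [] v a<b (fresh (fresh growth)) = contradiction (n≤1+n _) (<⇒≱ a<b)
Growth-swap (x ∷ u) v a<b (repeat x≤k growth) = repeat x≤k (Growth-swap u v a<b growth)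
Growth-swap (x ∷ u) v a<b (fresh growth) = fresh (Growth-swap u v a<b growth)

IsBL-downward : ∀ {m w w′} → All (1 ≤_) m → Cover w w′ → IsBL m w′ → IsBL m w
IsBL-downward m≥1 (swap u a b v a<b) bl@(labels , counts , _) =
  All-resp-↭ w′↭w labels ,
  (λ i 1≤i i≤n → trans (sym (count-↭ i w′↭w)) (counts i 1≤i i≤n)) ,
  Growth⇒firstOccsOrdered (Growth-swap u v a<b (IsBL⇒Growth m≥1 bl))
  where
  w′↭w = ↭-sym (cover⇒↭ (swap u a b v a<b))

InImage : List ℕ → List ℕ → Set
InImage m σ = IsBL m (map (blockOf m) σ) × phi m (map (blockOf m) σ) ≡ σ

-- Equal adjacent labels become consecutive increasing values, so the two values swapped by a
-- cover below φ(w) come from different labels, in increasing order.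
cover-InImage : ∀ {m σ σ′} → All (1 ≤_) m → Cover σ σ′ → InImage m σ′ →
  InImage m σ × Cover (map (blockOf m) σ) (map (blockOf m) σ′)
cover-InImage {m} m≥1 (swap u a b v a<b) (bl , phi≡) with m≤n⇒m<n∨m≡n (blockOf-mono m (<⇒≤ a<b))
... | inj₂ A≡B = contradiction (phi-repeated-label m u (blockOf m a) v upper) (<⇒≢ (<-trans a<b (n<1+n b)))
  where
  upper : phi m (map (blockOf m) u ++ blockOf m a ∷ blockOf m a ∷ map (blockOf m) v) ≡ u ++ b ∷ a ∷ v
  upper = trans (cong (λ B → phi m (map (blockOf m) u ++ B ∷ blockOf m a ∷ map (blockOf m) v)) A≡B)
                (trans (cong (phi m) (sym (map-++ (blockOf m) u (b ∷ a ∷ v)))) phi≡)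
... | inj₁ A<B = (subst (IsBL m) (sym lower-word) (IsBL-downward m≥1 lower-cover (subst (IsBL m) upper-word bl)) ,
                  lower-phi) ,
                 subst₂ Cover (sym lower-word) (sym upper-word) lower-cover
  where
  U = map (blockOf m) u
  V = map (blockOf m) v
  A = blockOf m a
  B = blockOf m b
  lower-word : map (blockOf m) (u ++ a ∷ b ∷ v) ≡ U ++ A ∷ B ∷ V
  lower-word = map-++ (blockOf m) u (a ∷ b ∷ v)
  upper-word : map (blockOf m) (u ++ b ∷ a ∷ v) ≡ U ++ B ∷ A ∷ V
  upper-word = map-++ (blockOf m) u (b ∷ a ∷ v)
  lower-cover = swap U A B V A<B
  split = phi-split m u (trans (cong (phi m) (sym upper-word)) phi≡)
  c = counterAfter (λ _ → 0) U
  adjacent = relabel-adjacent m c V (<⇒≢ A<B)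
  heads : entry m c B ∷ entry m c A ∷ relabel m (tick (tick c A) B) V ≡ b ∷ a ∷ v
  heads = trans (sym (proj₂ adjacent)) (proj₂ split)
  lower-phi : phi m (map (blockOf m) (u ++ a ∷ b ∷ v)) ≡ u ++ a ∷ b ∷ v
  lower-phi = begin
    phi m (map (blockOf m) (u ++ a ∷ b ∷ v)) ≡⟨ cong (phi m) lower-word ⟩
    phi m (U ++ A ∷ B ∷ V)                   ≡⟨ phi-++ m U (proj₁ adjacent) ⟩
    phi m U ++ entry m c A ∷ entry m c B ∷ relabel m (tick (tick c A) B) V
                                             ≡⟨ cong₂ _++_ (proj₁ split) (swap-heads heads) ⟩
    u ++ a ∷ b ∷ v                           ∎
    where open ≡-Reasoning

chain-InImage : ∀ {m σ σ′} → All (1 ≤_) m → Chain σ σ′ → InImage m σ′ →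
  InImage m σ × Leq (IsBL m) (map (blockOf m) σ) (map (blockOf m) σ′)
chain-InImage m≥1 ε image = image , ε
chain-InImage m≥1 (c ◅ cs) image′ =
  let image , steps = chain-InImage m≥1 cs image′
      image₀ , cover = cover-InImage m≥1 c image
  in image₀ , (proj₁ image₀ , proj₁ image , cover) ◅ steps

-- The minimal barcode

oneTo-suc : ∀ n → oneTo (suc n) ≡ 1 ∷ map suc (oneTo n)
oneTo-suc n = cong (λ xs → 1 ∷ map suc xs) (sym (map-upTo suc n))

oneTo-+ : ∀ a b → oneTo (a + b) ≡ oneTo a ++ map (a +_) (oneTo b)
oneTo-+ zero b = sym (map-id (oneTo b))
oneTo-+ (suc a) b = begin
  oneTo (suc a + b)                                   ≡⟨ oneTo-suc (a + b) ⟩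
  1 ∷ map suc (oneTo (a + b))                         ≡⟨ cong (λ xs → 1 ∷ map suc xs) (oneTo-+ a b) ⟩
  1 ∷ map suc (oneTo a ++ map (a +_) (oneTo b))       ≡⟨ cong (1 ∷_) (map-++ suc (oneTo a) _) ⟩
  1 ∷ map suc (oneTo a) ++ map suc (map (a +_) (oneTo b))
    ≡⟨ cong (λ xs → 1 ∷ map suc (oneTo a) ++ xs) (sym (map-∘ (oneTo b))) ⟩
  1 ∷ map suc (oneTo a) ++ map (suc a +_) (oneTo b)
    ≡⟨ cong (_++ map (suc a +_) (oneTo b)) (sym (oneTo-suc a)) ⟩
  oneTo (suc a) ++ map (suc a +_) (oneTo b)           ∎
  where open ≡-Reasoning

HasContent-∷ : ∀ {k ks w₁ w₂} → All (1 ≡_) w₁ → length w₁ ≡ k → HasContent ks w₂ →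
  HasContent (k ∷ ks) (w₁ ++ map suc w₂)
HasContent-∷ {k} {ks} {w₁} {w₂} ones |w₁|≡k content i = trans (count-++ i w₁ (map suc w₂)) (counts i)
  where
  others : ∀ {i} → 1 ≢ i → count i w₁ ≡ 0
  others 1≢i = count-none w₁ (All.map (λ 1≡x i≡x → 1≢i (trans 1≡x (sym i≡x))) ones)
  counts : ∀ i → count i w₁ + count i (map suc w₂) ≡ mAt (k ∷ ks) i
  counts zero = cong₂ _+_ (others (λ ())) (count-none (map suc w₂) (AllP.map⁺ (All.universal (λ _ ()) w₂)))
  counts (suc zero) = begin
    count 1 w₁ + count 1 (map suc w₂)
      ≡⟨ cong₂ _+_ (cong length (filter-all (1 ≟_) ones)) (count-map-suc 0 w₂) ⟩
    length w₁ + count 0 w₂            ≡⟨ cong₂ _+_ |w₁|≡k (trans (content 0) (mAt-zero ks)) ⟩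
    k + 0                             ≡⟨ +-identityʳ k ⟩
    k                                 ∎
    where open ≡-Reasoning
  counts (suc (suc j)) = cong₂ _+_ (others (λ ())) (trans (count-map-suc (suc j) w₂) (content (suc j)))

relabel-ones : ∀ k ks c {s} r → c 1 ≡ s → relabel (k ∷ ks) c (replicate r 1) ≡ map (s +_) (oneTo r)
relabel-ones k ks c zero _ = refl
relabel-ones k ks c {s} (suc r) c1≡s = begin
  suc (c 1) ∷ relabel (k ∷ ks) (tick c 1) (replicate r 1)
    ≡⟨ cong₂ _∷_ (cong suc c1≡s)
                 (relabel-ones k ks (tick c 1) r (trans (tick-here c 1) (cong suc c1≡s))) ⟩
  suc s ∷ map (suc s +_) (oneTo r)
    ≡⟨ cong₂ _∷_ (+-comm 1 s) (trans (map-cong (λ j → sym (+-suc s j)) (oneTo r)) (map-∘ (oneTo r))) ⟩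
  map (s +_) (1 ∷ map suc (oneTo r))
    ≡⟨ cong (map (s +_)) (sym (oneTo-suc r)) ⟩
  map (s +_) (oneTo (suc r)) ∎
  where open ≡-Reasoning

relabel-map-suc : ∀ k ks c w → All (1 ≤_) w →
  relabel (k ∷ ks) c (map suc w) ≡ map (k +_) (relabel ks (c ∘ suc) w)
relabel-map-suc k ks c [] [] = refl
relabel-map-suc k ks c (suc j ∷ w) (_ ∷ w≥1) =
  cong₂ _∷_ (+-assoc k (psum ks j) _) (relabel-map-suc k ks (tick c (suc (suc j))) w w≥1)

minBarcode : List ℕ → List ℕ
minBarcode [] = []
minBarcode (k ∷ ks) = replicate k 1 ++ map suc (minBarcode ks)

minBarcode-content : ∀ m → HasContent m (minBarcode m)
minBarcode-content [] _ = refl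
minBarcode-content (k ∷ ks) = HasContent-∷ (AllP.replicate⁺ k refl) (length-replicate k) (minBarcode-content ks)

minBarcode-sorted : ∀ m → AllPairs _≤_ (minBarcode m)
minBarcode-sorted [] = []
minBarcode-sorted (k ∷ ks) = AllPairsP.++⁺ (replicate-sorted k ≤-refl)
  (AllPairsP.map⁺ (AllPairs.map s≤s (minBarcode-sorted ks)))
  (AllP.replicate⁺ k (AllP.map⁺ (All.universal (λ _ → s≤s z≤n) (minBarcode ks))))

phi-minBarcode : ∀ m → phi m (minBarcode m) ≡ oneTo (total m)
phi-minBarcode [] = refl
phi-minBarcode (k ∷ ks) = begin
  phi (k ∷ ks) (replicate k 1 ++ map suc B)
    ≡⟨ relabel-++ (k ∷ ks) (λ _ → 0) (replicate k 1) (map suc B) ⟩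
  phi (k ∷ ks) (replicate k 1) ++ relabel (k ∷ ks) c (map suc B)
    ≡⟨ cong₂ _++_ (trans (relabel-ones k ks (λ _ → 0) k refl) (map-id (oneTo k)))
                  (relabel-map-suc k ks c B B≥1) ⟩
  oneTo k ++ map (k +_) (relabel ks (c ∘ suc) B)
    ≡⟨ cong (λ xs → oneTo k ++ map (k +_) xs) (relabel-cong ks B (All.map c∘suc≡0 B≥1)) ⟩
  oneTo k ++ map (k +_) (phi ks B)
    ≡⟨ cong (λ xs → oneTo k ++ map (k +_) xs) (phi-minBarcode ks) ⟩
  oneTo k ++ map (k +_) (oneTo (total ks))
    ≡⟨ sym (oneTo-+ k (total ks)) ⟩
  oneTo (k + total ks) ∎
  where
  open ≡-Reasoning
  B = minBarcode ks
  B≥1 = All.map proj₁ (HasContent⇒labels {ks} (minBarcode-content ks))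
  c = counterAfter (λ _ → 0) (replicate k 1)
  c∘suc≡0 : ∀ {j} → 1 ≤ j → c (suc j) ≡ 0
  c∘suc≡0 {suc j} _ = trans (counterAfter-count (λ _ → 0) (replicate k 1) (suc (suc j)))
    (count-none (replicate k 1) (AllP.replicate⁺ k λ ()))

sort≡minBarcode : ∀ m {w} → HasContent m w → sort w ≡ minBarcode m
sort≡minBarcode m {w} content = AllPairs-count⇒≡ ≤-antisym (sort-sorted w) (minBarcode-sorted m)
  (λ i → trans (count-↭ i (chain⇒↭ (sort-chain w))) (trans (content i) (sym (minBarcode-content m i))))

identity-chain-phi : ∀ {m w} → HasContent m w → Chain (oneTo (total m)) (phi m w)
identity-chain-phi {m} {w} content =
  subst (λ σ → Chain σ (phi m w)) (phi-minBarcode m) (phi-chain m (minBarcode-content m) bottom-chain-w)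
  where
  bottom-chain-w : Chain (minBarcode m) w
  bottom-chain-w = subst (λ v → Chain v w) (sort≡minBarcode m {w} content) (sort-chain w)

-- The maximal barcode

records : ℕ → List ℕ → List ℕ
records k [] = []
records k (x ∷ w) with x ≤? k
... | yes _ = records k w
... | no _ = x ∷ records x w

nonRecords : ℕ → List ℕ → List ℕ
nonRecords k [] = []
nonRecords k (x ∷ w) with x ≤? k
... | yes _ = x ∷ nonRecords k w
... | no _ = nonRecords x w

records-above : ∀ k w → All (k <_) (records k w)
records-above k [] = []
records-above k (x ∷ w) with x ≤? k
... | yes _ = records-above k w
... | no x≰k = ≰⇒> x≰k ∷ All.map (<-trans (≰⇒> x≰k)) (records-above x w)

records-chain : ∀ k w → Chain w (records k w ++ nonRecords k w)
records-chain k [] = ε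
records-chain k (x ∷ w) with x ≤? k
... | yes x≤k = chain-++⁺ˡ [ x ] (records-chain k w) ◅◅
  chain-bubble x (records k w) (nonRecords k w) (All.map (≤-<-trans x≤k) (records-above k w))
... | no _ = chain-++⁺ˡ [ x ] (records-chain x w)

interval : ℕ → ℕ → List ℕ
interval k zero = []
interval k (suc d) = suc k ∷ interval (suc k) d

interval-suc : ∀ k d → map suc (interval k d) ≡ interval (suc k) d
interval-suc k zero = refl
interval-suc k (suc d) = cong (suc (suc k) ∷_) (interval-suc (suc k) d)

interval-oneTo : ∀ n → interval 0 n ≡ oneTo n
interval-oneTo zero = refl
interval-oneTo (suc n) = begin
  1 ∷ interval 1 n           ≡⟨ cong (1 ∷_) (sym (interval-suc 0 n)) ⟩
  1 ∷ map suc (interval 0 n) ≡⟨ cong (λ xs → 1 ∷ map suc xs) (interval-oneTo n) ⟩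
  1 ∷ map suc (oneTo n)      ≡⟨ sym (oneTo-suc n) ⟩
  oneTo (suc n)              ∎
  where open ≡-Reasoning

records-Growth : ∀ {k d w} → Growth k d w → records k w ≡ interval k d
records-Growth done = refl
records-Growth {k} (repeat {x = x} x≤k growth) with x ≤? k
... | yes _ = records-Growth growth
... | no x≰k = contradiction x≤k x≰k
records-Growth {k} (fresh growth) with suc k ≤? k
... | yes k<k = contradiction k<k (n≮n k)
... | no _ = cong (suc k ∷_) (records-Growth growth)

Growth-interval : ∀ k d w → All (_≤ k + d) w → Growth k d (interval k d ++ w)
Growth-interval k zero [] [] = done
Growth-interval k zero (x ∷ w) (x≤k+0 ∷ w≤k+0) =
  repeat (subst (x ≤_) (+-identityʳ k) x≤k+0) (Growth-interval k zero w w≤k+0)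
Growth-interval k (suc d) w w≤k+d =
  fresh (Growth-interval (suc k) d w (All.map (λ {x} → subst (x ≤_) (+-suc k d)) w≤k+d))

repeats : List ℕ → List ℕ
repeats [] = []
repeats (k ∷ ks) = map suc (repeats ks) ++ replicate (k ∸ 1) 1

maxBarcode : List ℕ → List ℕ
maxBarcode m = oneTo (length m) ++ repeats m

maxBarcode-∷ : ∀ k ks → maxBarcode (k ∷ ks) ≡ 1 ∷ map suc (maxBarcode ks) ++ replicate (k ∸ 1) 1
maxBarcode-∷ k ks = begin
  oneTo (suc n) ++ map suc R ++ ones                 ≡⟨ cong (_++ map suc R ++ ones) (oneTo-suc n) ⟩
  1 ∷ map suc (oneTo n) ++ map suc R ++ ones
    ≡⟨ cong (1 ∷_) (sym (++-assoc (map suc (oneTo n)) _ ones)) ⟩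
  1 ∷ (map suc (oneTo n) ++ map suc R) ++ ones
    ≡⟨ cong (λ xs → 1 ∷ xs ++ ones) (sym (map-++ suc (oneTo n) R)) ⟩
  1 ∷ map suc (oneTo n ++ R) ++ ones                 ∎
  where
  open ≡-Reasoning
  n = length ks
  R = repeats ks
  ones = replicate (k ∸ 1) 1

maxBarcode-content : ∀ {m} → All (1 ≤_) m → HasContent m (maxBarcode m)
maxBarcode-content [] _ = refl
maxBarcode-content {suc k ∷ ks} (_ ∷ ks≥1) = HasContent-↭ (suc k ∷ ks) reorder
  (HasContent-∷ (AllP.replicate⁺ (suc k) refl) (length-replicate (suc k)) (maxBarcode-content ks≥1))
  where
  reorder : replicate (suc k) 1 ++ map suc (maxBarcode ks) ↭ maxBarcode (suc k ∷ ks)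
  reorder = ↭-trans (prep 1 (++-comm (replicate k 1) (map suc (maxBarcode ks))))
                    (↭-reflexive (sym (maxBarcode-∷ (suc k) ks)))

maxBarcode-IsBL : ∀ {m} → All (1 ≤_) m → IsBL m (maxBarcode m)
maxBarcode-IsBL {m} m≥1 = labels , (λ i _ _ → content i) , Growth⇒firstOccsOrdered growth
  where
  n = length m
  content = maxBarcode-content m≥1
  labels = HasContent⇒labels {m} content
  growth : Growth 0 n (maxBarcode m)
  growth = subst (λ xs → Growth 0 n (xs ++ repeats m)) (interval-oneTo n)
    (Growth-interval 0 n (repeats m) (AllP.++⁻ʳ (oneTo n) (All.map proj₂ labels)))

repeats-sorted : ∀ m → AllPairs _≥_ (repeats m)
repeats-sorted [] = []
repeats-sorted (k ∷ ks) = AllPairsP.++⁺ (AllPairsP.map⁺ (AllPairs.map s≤s (repeats-sorted ks)))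
  (replicate-sorted (k ∸ 1) ≤-refl)
  (AllP.map⁺ (All.universal (λ _ → AllP.replicate⁺ (k ∸ 1) (s≤s z≤n)) (repeats ks)))

sortDesc-nonRecords : ∀ {m w} → All (1 ≤_) m → IsBL m w → Desc.sort (nonRecords 0 w) ≡ repeats m
sortDesc-nonRecords {m} {w} m≥1 bl =
  AllPairs-count⇒≡ (flip ≤-antisym) (sortDesc-sorted N) (repeats-sorted m) counts
  where
  n = length m
  N = nonRecords 0 w
  records≡ : records 0 w ≡ oneTo n
  records≡ = trans (records-Growth (IsBL⇒Growth m≥1 bl)) (interval-oneTo n)
  sorting-keeps-count : ∀ {i} → count i N ≡ count i (Desc.sort N)
  sorting-keeps-count {i} = count-↭ i (chain⇒↭ (sortDesc-chain N))
  counts : ∀ i → count i (Desc.sort N) ≡ count i (repeats m)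
  counts i = +-cancelˡ-≡ (count i (oneTo n)) _ _ (begin
    count i (oneTo n) + count i (Desc.sort N) ≡⟨ cong (count i (oneTo n) +_) (sym sorting-keeps-count) ⟩
    count i (oneTo n) + count i N             ≡⟨ cong (λ xs → count i xs + count i N) (sym records≡) ⟩
    count i (records 0 w) + count i N         ≡⟨ sym (count-++ i (records 0 w) N) ⟩
    count i (records 0 w ++ N)                ≡⟨ sym (count-↭ i (chain⇒↭ (records-chain 0 w))) ⟩
    count i w                                 ≡⟨ IsBL⇒HasContent m bl i ⟩
    mAt m i                                   ≡⟨ sym (maxBarcode-content m≥1 i) ⟩
    count i (oneTo n ++ repeats m)            ≡⟨ count-++ i (oneTo n) (repeats m) ⟩
    count i (oneTo n) + count i (repeats m)   ∎)
    where open ≡-Reasoning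

chain-maxBarcode : ∀ {m w} → All (1 ≤_) m → IsBL m w → Chain w (maxBarcode m)
chain-maxBarcode {m} {w} m≥1 bl = records-chain 0 w ◅◅
  subst (Chain (records 0 w ++ nonRecords 0 w))
    (cong₂ _++_ (trans (records-Growth (IsBL⇒Growth m≥1 bl)) (interval-oneTo (length m)))
                (sortDesc-nonRecords m≥1 bl))
    (chain-++⁺ˡ (records 0 w) (sortDesc-chain (nonRecords 0 w)))

blockStarts-∷ : ∀ k ks → map (λ j → psum (k ∷ ks) j + 1) (applyUpTo suc (length ks))
                         ≡ map (k +_) (map (λ j → psum ks j + 1) (upTo (length ks)))
blockStarts-∷ k ks = begin
  map (λ j → psum (k ∷ ks) j + 1) (applyUpTo suc n)         ≡⟨ cong (map _) (sym (map-upTo suc n)) ⟩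
  map (λ j → psum (k ∷ ks) j + 1) (map suc (upTo n))        ≡⟨ sym (map-∘ (upTo n)) ⟩
  map (λ j → k + psum ks j + 1) (upTo n)                    ≡⟨ map-cong (λ j → +-assoc k _ 1) (upTo n) ⟩
  map (λ j → k + (psum ks j + 1)) (upTo n)                  ≡⟨ map-∘ (upTo n) ⟩
  map (k +_) (map (λ j → psum ks j + 1) (upTo n))           ∎
  where
  open ≡-Reasoning
  n = length ks

restBlock-∷ : ∀ k ks {j} → 1 ≤ j → restBlock (k ∷ ks) (suc j) ≡ map (k +_) (restBlock ks j)
restBlock-∷ k ks {suc j} _ = trans (map-cong (λ t → +-assoc k (psum ks j) (suc (suc t))) _) (map-∘ _)

restBlocks-∷ : ∀ k ks → concat (map (restBlock (k ∷ ks)) (reverse (oneTo (suc (length ks)))))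
  ≡ map (k +_) (concat (map (restBlock ks) (reverse (oneTo (length ks))))) ++ map suc (oneTo (k ∸ 1))
restBlocks-∷ k ks = begin
  concat (map g (reverse (oneTo (suc n))))
    ≡⟨ cong (concat ∘ map g) reverse-oneTo-suc ⟩
  concat (map g (map suc L ++ [ 1 ]))
    ≡⟨ cong concat (map-++ g (map suc L) [ 1 ]) ⟩
  concat (map g (map suc L) ++ [ g 1 ])
    ≡⟨ sym (concat-++ (map g (map suc L)) [ g 1 ]) ⟩
  concat (map g (map suc L)) ++ g 1 ++ []
    ≡⟨ cong₂ _++_ shifted (trans (++-identityʳ (g 1)) (map-∘ (upTo (k ∸ 1)))) ⟩
  map (k +_) (concat (map (restBlock ks) L)) ++ map suc (oneTo (k ∸ 1)) ∎
  where
  open ≡-Reasoning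
  n = length ks
  L = reverse (oneTo n)
  g = restBlock (k ∷ ks)
  reverse-oneTo-suc : reverse (oneTo (suc n)) ≡ map suc L ++ [ 1 ]
  reverse-oneTo-suc = trans (cong reverse (oneTo-suc n))
    (trans (unfold-reverse 1 (map suc (oneTo n))) (cong (_∷ʳ 1) (sym (reverse-map suc (oneTo n)))))
  L≥1 : All (1 ≤_) L
  L≥1 = All-resp-↭ (↭-sym (↭-reverse (oneTo n))) (AllP.map⁺ (All.universal (λ _ → s≤s z≤n) (upTo n)))
  shifted : concat (map g (map suc L)) ≡ map (k +_) (concat (map (restBlock ks) L))
  shifted = trans (cong concat (trans (sym (map-∘ L))
                                     (trans (map-cong-local (All.map (restBlock-∷ k ks) L≥1)) (map-∘ L))))
                  (concat-map (map (restBlock ks) L))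

beta-∷ : ∀ k ks → beta (k ∷ ks) ≡ 1 ∷ map (k +_) (beta ks) ++ map suc (oneTo (k ∸ 1))
beta-∷ k ks = begin
  1 ∷ map (λ j → psum (k ∷ ks) j + 1) (applyUpTo suc n)
    ++ concat (map (restBlock (k ∷ ks)) (reverse (oneTo (suc n))))
    ≡⟨ cong₂ (λ xs ys → 1 ∷ xs ++ ys) (blockStarts-∷ k ks) (restBlocks-∷ k ks) ⟩
  1 ∷ map (k +_) starts ++ map (k +_) rests ++ ones
    ≡⟨ cong (1 ∷_) (sym (++-assoc (map (k +_) starts) _ ones)) ⟩
  1 ∷ (map (k +_) starts ++ map (k +_) rests) ++ ones
    ≡⟨ cong (λ xs → 1 ∷ xs ++ ones) (sym (map-++ (k +_) starts rests)) ⟩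
  1 ∷ map (k +_) (starts ++ rests) ++ ones ∎
  where
  open ≡-Reasoning
  n = length ks
  starts = map (λ j → psum ks j + 1) (upTo n)
  rests = concat (map (restBlock ks) (reverse (oneTo n)))
  ones = map suc (oneTo (k ∸ 1))

phi-maxBarcode : ∀ {m} → All (1 ≤_) m → phi m (maxBarcode m) ≡ beta m
phi-maxBarcode [] = refl
phi-maxBarcode {k ∷ ks} (_ ∷ ks≥1) = begin
  phi (k ∷ ks) (maxBarcode (k ∷ ks))
    ≡⟨ cong (phi (k ∷ ks)) (maxBarcode-∷ k ks) ⟩
  1 ∷ relabel (k ∷ ks) c (map suc T ++ replicate (k ∸ 1) 1)
    ≡⟨ cong (1 ∷_) (relabel-++ (k ∷ ks) c (map suc T) (replicate (k ∸ 1) 1)) ⟩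
  1 ∷ relabel (k ∷ ks) c (map suc T) ++ relabel (k ∷ ks) (counterAfter c (map suc T)) (replicate (k ∸ 1) 1)
    ≡⟨ cong₂ (λ xs ys → 1 ∷ xs ++ ys) (relabel-map-suc k ks c T T≥1)
                                     (relabel-ones k ks _ (k ∸ 1) one-seen) ⟩
  1 ∷ map (k +_) (relabel ks (c ∘ suc) T) ++ map suc (oneTo (k ∸ 1))
    ≡⟨ cong (λ xs → 1 ∷ map (k +_) xs ++ map suc (oneTo (k ∸ 1)))
            (trans (relabel-cong ks T (All.map c∘suc≡0 T≥1)) (phi-maxBarcode ks≥1)) ⟩
  1 ∷ map (k +_) (beta ks) ++ map suc (oneTo (k ∸ 1))
    ≡⟨ sym (beta-∷ k ks) ⟩
  beta (k ∷ ks) ∎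
  where
  open ≡-Reasoning
  T = maxBarcode ks
  content = maxBarcode-content ks≥1
  T≥1 = All.map proj₁ (HasContent⇒labels {ks} content)
  c = tick (λ _ → 0) 1
  c∘suc≡0 : ∀ {j} → 1 ≤ j → c (suc j) ≡ 0
  c∘suc≡0 {suc j} _ = refl
  one-seen : counterAfter c (map suc T) 1 ≡ 1
  one-seen = begin
    counterAfter c (map suc T) 1 ≡⟨ counterAfter-count c (map suc T) 1 ⟩
    1 + count 1 (map suc T)      ≡⟨ cong suc (trans (count-map-suc 0 T) (trans (content 0) (mAt-zero ks))) ⟩
    1                            ∎

phi-InInterval : ∀ {m w} → All (1 ≤_) m → IsBL m w → InInterval m (phi m w)
phi-InInterval {m} {w} m≥1 bl = isPerm , chain⇒Leq bottom ↭-refl , chain⇒Leq top isPerm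
  where
  content = IsBL⇒HasContent m bl
  bottom : Chain (oneTo (total m)) (phi m w)
  bottom = identity-chain-phi content
  isPerm : IsPerm (total m) (phi m w)
  isPerm = ↭-sym (chain⇒↭ bottom)
  top : Chain (phi m w) (beta m)
  top = subst (Chain (phi m w)) (phi-maxBarcode m≥1) (phi-chain m content (chain-maxBarcode m≥1 bl))

phi-InImage : ∀ {m w} → IsBL m w → InImage m (phi m w)
phi-InImage {m} bl = subst (IsBL m) (sym (blockOf-phi content)) bl , cong (phi m) (blockOf-phi content)
  where content = IsBL⇒HasContent m bl

phi-injective : ∀ {m w w′} → HasContent m w → HasContent m w′ → phi m w ≡ phi m w′ → w ≡ w′
phi-injective {m} content content′ eq =
  trans (sym (blockOf-phi content)) (trans (cong (map (blockOf m)) eq) (blockOf-phi content′))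

InInterval⇒InImage : ∀ {m σ} → All (1 ≤_) m → InInterval m σ → InImage m σ
InInterval⇒InImage {m} m≥1 (_ , _ , σ≤β) = proj₁ (chain-InImage m≥1 (Leq⇒chain σ≤β) β-InImage)
  where
  β-InImage : InImage m (beta m)
  β-InImage = subst (InImage m) (phi-maxBarcode m≥1) (phi-InImage (maxBarcode-IsBL m≥1))

phi-mono : ∀ {m w w′} → All (1 ≤_) m → IsBL m w →
  Leq (IsBL m) w w′ → Leq (IsPerm (total m)) (phi m w) (phi m w′)
phi-mono {m} m≥1 bl w≤w′ =
  chain⇒Leq (phi-chain m (IsBL⇒HasContent m bl) (Leq⇒chain w≤w′)) (proj₁ (phi-InInterval m≥1 bl))

phi-mono⁻ : ∀ {m w w′} → All (1 ≤_) m → IsBL m w → IsBL m w′ →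
  Leq (IsPerm (total m)) (phi m w) (phi m w′) → Leq (IsBL m) w w′
phi-mono⁻ {m} m≥1 bl bl′ φw≤φw′ =
  subst₂ (Leq (IsBL m)) (blockOf-phi (IsBL⇒HasContent m bl)) (blockOf-phi (IsBL⇒HasContent m bl′))
    (proj₂ (chain-InImage m≥1 (Leq⇒chain φw≤φw′) (phi-InImage bl′)))

proposition3p1 : (m : List ℕ) → 1 ≤ length m → All (1 ≤_) m →
    (∀ w → IsBL m w → InInterval m (phi m w))
    × (∀ w w′ → IsBL m w → IsBL m w′ → phi m w ≡ phi m w′ → w ≡ w′)
    × (∀ σ → InInterval m σ → ∃ λ w → IsBL m w × phi m w ≡ σ)
    × (∀ w w′ → IsBL m w → IsBL m w′ →
         (Leq (IsBL m) w w′ → Leq (IsPerm (total m)) (phi m w) (phi m w′))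
         × (Leq (IsPerm (total m)) (phi m w) (phi m w′) → Leq (IsBL m) w w′))
proposition3p1 m _ m≥1 =
  (λ _ → phi-InInterval m≥1) ,
  (λ _ _ bl bl′ → phi-injective (IsBL⇒HasContent m bl) (IsBL⇒HasContent m bl′)) ,
  (λ σ σ∈[e,β] → let bl , phi≡ = InInterval⇒InImage m≥1 σ∈[e,β] in map (blockOf m) σ , bl , phi≡) ,
  (λ _ _ bl bl′ → phi-mono m≥1 bl , phi-mono⁻ m≥1 bl bl′)
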